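{- Every finite monoid $M$ is isomorphic to the endomorphism monoid of a binary relational system in which every vertex has the same total degree.
   Context: A binary relational system is a finite set $V$ together with finitely many relations $A_i\subseteq V^2$ (viewed as coloured arcs). An endomorphism is a map $V\to V$ preserving each relation; the endomorphisms form a monoid under composition. The total degree of a vertex is the number of incoming plus outgoing arcs at it, summed over all relations. -}

module Defs where

open import Level using (Level; 0ℓ)
open import Data.Nat using (ℕ; _+_)
open import Data.Bool using (Bool; true; false)
open import Data.Fin using (Fin)
open import Data.List using (List; map; allFin)
open import Data.Nat.ListAction using (sum)
open import Data.Product using (Σ; _×_; _,_; ∃; ∃-syntax)
open import Relation.Binary.PropositionalEquality
  using (_≡_; refl; sym; trans; cong; cong₂; isEquivalence)
open import Relation.Binary.Bundles using (Setoid)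
open import Function using (_∘_; id)
open import Function.Bundles using (Bijection)
open import Relation.Binary.PropositionalEquality.Properties using (setoid)
open import Algebra.Bundles using (Monoid)
open import Algebra.Structures using (IsMonoid)
open import Algebra.Morphism.Structures using (module MonoidMorphisms)

RelSystem : ℕ → ℕ → Set
RelSystem n k = Fin k → Fin n → Fin n → Bool

ΣFin : (m : ℕ) → (Fin m → ℕ) → ℕ
ΣFin m f = sum (map f (allFin m))

⟦_⟧ᵇ : Bool → ℕ
⟦ true ⟧ᵇ = 1
⟦ false ⟧ᵇ = 0

-- Total degree of vertex v: number of outgoing plus incoming arcs at v,
-- summed over all relations (a loop counts once as outgoing and once as incoming).
totalDegree : ∀ {n k} → RelSystem n k → Fin n → ℕ
totalDegree {n} {k} A v =
  ΣFin k (λ i → ΣFin n (λ u → ⟦ A i v u ⟧ᵇ + ⟦ A i u v ⟧ᵇ))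

record Endo {n k : ℕ} (A : RelSystem n k) : Set where
  constructor endo
  field
    fun   : Fin n → Fin n
    preserves : ∀ i u w → A i u w ≡ true → A i (fun u) (fun w) ≡ true
open Endo public

idEndo : ∀ {n k} (A : RelSystem n k) → Endo A
idEndo A = endo id (λ i u w p → p)

_∘ᴱ_ : ∀ {n k} {A : RelSystem n k} → Endo A → Endo A → Endo A
f ∘ᴱ g = endo (fun f ∘ fun g)
  (λ i u w p → preserves f i (fun g u) (fun g w) (preserves g i u w p))

_≈ᴱ_ : ∀ {n k} {A : RelSystem n k} → Endo A → Endo A → Set
f ≈ᴱ g = ∀ x → fun f x ≡ fun g x

EndMonoid : ∀ {n k} → RelSystem n k → Monoid 0ℓ 0ℓ
EndMonoid A = record
  { Carrier = Endo A
  ; _≈_ = _≈ᴱ_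
  ; _∙_ = _∘ᴱ_
  ; ε = idEndo A
  ; isMonoid = record
    { isSemigroup = record
      { isMagma = record
        { isEquivalence = record
          { refl = λ x → refl
          ; sym = λ p x → sym (p x)
          ; trans = λ p q x → trans (p x) (q x) }
        ; ∙-cong = λ {f} {f'} {g} {g'} p q x → trans (cong (fun f) (q x)) (p (fun g' x)) }
      ; assoc = λ f g h x → refl }
    ; identity = (λ f x → refl) , (λ f x → refl) }
  }

IsFiniteMonoid : ∀ {c ℓ} → Monoid c ℓ → Set (c Level.⊔ ℓ)
IsFiniteMonoid M = ∃[ m ] Bijection (setoid (Fin m)) (Monoid.setoid M)

_≅ᴹ_ : ∀ {a b ℓ₁ ℓ₂} → Monoid a ℓ₁ → Monoid b ℓ₂ → Set (a Level.⊔ b Level.⊔ ℓ₁ Level.⊔ ℓ₂)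
M ≅ᴹ N = Σ (Monoid.Carrier M → Monoid.Carrier N)
  (MonoidMorphisms.IsMonoidIsomorphism (Monoid.rawMonoid M) (Monoid.rawMonoid N))

-- Transport M to a monoid structure on Fin n and let it act by left multiplication on these
-- vertices: the elements of M and, for every a, one gadget vertex for each triple (x, y, z)
-- with z ≡ y or z ≡ x · a (acted on coordinatewise). For every a there are the right Cayley
-- arcs x → x · a and the arcs from each a-gadget to its three coordinates, and there are loops
-- at the gadget vertices. An endomorphism G preserves the Cayley arcs, so on M it is left
-- multiplication by i₀ = G e; as a triple is determined by its coordinates, G then sends each
-- gadget to the one with coordinates multiplied by i₀.
--
-- If A elements x satisfy x · a ≡ v, the vertex v is met by 1 + A Cayley arcs and is the
-- Y-coordinate of 2n − A and the Z-coordinate of n + (n − 1) A of the a-triples, so taking the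
-- Y-projection n times makes A cancel and all monoid vertices get the same degree. All gadget
-- vertices share a smaller degree, and the loops close the gap.

module Submission where

open import Level using (0ℓ)
open import Data.Nat using (ℕ; zero; suc; _+_; _*_; _∸_; _≤_)
open import Data.Nat.Properties
  using (+-0-commutativeMonoid; +-assoc; +-comm; +-identityʳ; *-identityʳ; *-zeroʳ; *-comm; *-distribˡ-+;
         m∸n+n≡m; m≤n*m; n≤1+n; +-mono-≤; ≤-trans)
open import Data.Nat.Tactic.RingSolver using (solve-∀)
import Data.Nat.ListAction as List
open import Data.Bool using (Bool; true; false; _∧_)
open import Data.Fin using (Fin; zero; suc; _↑ˡ_; _↑ʳ_; splitAt; join; remQuot; combine; punchIn; punchOut)
open import Data.Fin.Properties
  using (_≟_; splitAt-↑ˡ; splitAt-↑ʳ; join-splitAt; remQuot-combine; combine-remQuot;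
         punchIn-injective; punchInᵢ≢i; punchIn-punchOut)
open import Data.Sum using (_⊎_; inj₁; inj₂; [_,_]′)
open import Data.Sum.Properties using (inj₁-injective)
open import Data.Product using (Σ; _×_; _,_; proj₁; proj₂; ∃-syntax)
open import Data.Empty using (⊥-elim)
open import Data.List using (map; tabulate)
open import Data.List.Properties using (map-tabulate)
open import Algebra.Core using (Op₂)
open import Algebra.Bundles using (Monoid; RawMonoid)
open import Algebra.Structures using (IsMonoid)
open import Algebra.Morphism.Structures using (module MonoidMorphisms)
import Algebra.Morphism.MonoidMonomorphism as MonoidMonomorphism
open import Algebra.Morphism.Construct.Composition using (isMonoidIsomorphism)
open import Algebra.Properties.CommutativeMonoid.Sum +-0-commutativeMonoid
  using (sum; sum-syntax; sum-cong-≗; ∑-distrib-+; ∑-comm; sum-remove; sum-replicate-zero)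
open import Function using (_∘_; id; mk⇔)
open import Function.Bundles using (Bijection; Inverse)
open import Function.Properties.Bijection using (Bijection⇒Inverse)
open import Relation.Nullary using (does; yes; no)
open import Relation.Nullary.Decidable using (dec-true; dec-false; does-⇔)
open import Relation.Binary.PropositionalEquality
open import Relation.Binary.PropositionalEquality.Properties using (setoid)
open ≡-Reasoning
open import Defs

-- Finite sums and Kronecker deltas

infix 4 _==_

_==_ : ∀ {m} → Fin m → Fin m → Bool
x == y = does (x ≟ y)

≡⇒== : ∀ {m} {x y : Fin m} → x ≡ y → (x == y) ≡ true
≡⇒== {x = x} {y} = dec-true (x ≟ y)

==-refl : ∀ {m} (x : Fin m) → (x == x) ≡ true
==-refl x = ≡⇒== {x = x} refl

≢⇒==-false : ∀ {m} {x y : Fin m} → x ≢ y → (x == y) ≡ false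
≢⇒==-false {x = x} {y} = dec-false (x ≟ y)

==⇒≡ : ∀ {m} {x y : Fin m} → (x == y) ≡ true → x ≡ y
==⇒≡ {x = x} {y} h with x ≟ y
... | yes x≡y = x≡y
==⇒≡ () | no _

==-comm : ∀ {m} (x y : Fin m) → (x == y) ≡ (y == x)
==-comm x y = does-⇔ (mk⇔ sym sym) (x ≟ y) (y ≟ x)

∧-true : ∀ {β γ} → β ∧ γ ≡ true → β ≡ true × γ ≡ true
∧-true {true} {true} refl = refl , refl

∧-intro : ∀ {β γ} → β ≡ true → γ ≡ true → β ∧ γ ≡ true
∧-intro refl refl = refl

ΣFin≡∑ : ∀ m (f : Fin m → ℕ) → ΣFin m f ≡ ∑[ i < m ] f i
ΣFin≡∑ zero f = refl
ΣFin≡∑ (suc m) f = cong (f zero +_) (begin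
  List.sum (map f (tabulate suc))                  ≡⟨ cong List.sum (map-tabulate suc f) ⟩
  List.sum (tabulate (f ∘ suc))                    ≡⟨ cong List.sum (map-tabulate id (f ∘ suc)) ⟨
  ΣFin m (f ∘ suc)                                 ≡⟨ ΣFin≡∑ m (f ∘ suc) ⟩
  ∑[ i < m ] f (suc i)                             ∎)

∑-const : ∀ m k → ∑[ i < m ] k ≡ m * k
∑-const zero k = refl
∑-const (suc m) k = cong (k +_) (∑-const m k)

∑-1 : ∀ m → ∑[ i < m ] 1 ≡ m
∑-1 m = trans (∑-const m 1) (*-identityʳ m)

∑-↑ : ∀ m {n} (f : Fin (m + n) → ℕ) →
      ∑[ i < m + n ] f i ≡ ∑[ i < m ] f (i ↑ˡ n) + ∑[ j < n ] f (m ↑ʳ j)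
∑-↑ zero f = refl
∑-↑ (suc m) f = trans (cong (f zero +_) (∑-↑ m (f ∘ suc))) (sym (+-assoc (f zero) _ _))

∑-combine : ∀ m n (f : Fin (m * n) → ℕ) →
            ∑[ k < m * n ] f k ≡ ∑[ i < m ] ∑[ j < n ] f (combine i j)
∑-combine zero n f = refl
∑-combine (suc m) n f =
  trans (∑-↑ n f) (cong (∑[ j < n ] f (j ↑ˡ m * n) +_) (∑-combine m n (f ∘ (n ↑ʳ_))))

∑-select : ∀ {m} (t : Fin m) (f : Fin m → ℕ) → ∑[ i < m ] (⟦ t == i ⟧ᵇ * f i) ≡ f t
∑-select {suc m} t f = begin
  ∑[ i < suc m ] (⟦ t == i ⟧ᵇ * f i)
    ≡⟨ sum-remove {i = t} (λ i → ⟦ t == i ⟧ᵇ * f i) ⟩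
  ⟦ t == t ⟧ᵇ * f t + ∑[ j < m ] (⟦ t == punchIn t j ⟧ᵇ * f (punchIn t j))
    ≡⟨ cong₂ _+_ (cong (λ b → ⟦ b ⟧ᵇ * f t) (==-refl t)) (sum-cong-≗ off-t) ⟩
  (f t + 0) + ∑[ j < m ] 0
    ≡⟨ cong₂ _+_ (+-identityʳ (f t)) (sum-replicate-zero m) ⟩
  f t + 0
    ≡⟨ +-identityʳ (f t) ⟩
  f t ∎
  where
  off-t : ∀ j → ⟦ t == punchIn t j ⟧ᵇ * f (punchIn t j) ≡ 0
  off-t j = cong (λ b → ⟦ b ⟧ᵇ * f (punchIn t j)) (≢⇒==-false (punchInᵢ≢i t j ∘ sym))

∑-select′ : ∀ {m} (t : Fin m) (f : Fin m → ℕ) → ∑[ i < m ] (⟦ i == t ⟧ᵇ * f i) ≡ f t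
∑-select′ t f = trans (sum-cong-≗ (λ i → cong (λ b → ⟦ b ⟧ᵇ * f i) (==-comm i t))) (∑-select t f)

∑-δ : ∀ {m} (t : Fin m) → ∑[ i < m ] ⟦ t == i ⟧ᵇ ≡ 1
∑-δ t = trans (sum-cong-≗ (λ i → sym (*-identityʳ ⟦ t == i ⟧ᵇ))) (∑-select t (λ _ → 1))

∑-δ′ : ∀ {m} (t : Fin m) → ∑[ i < m ] ⟦ i == t ⟧ᵇ ≡ 1
∑-δ′ t = trans (sum-cong-≗ (λ i → sym (*-identityʳ ⟦ i == t ⟧ᵇ))) (∑-select′ t (λ _ → 1))

-- Finite types given by codes

data Code : Set where
  fin : ℕ → Code
  _⊕_ _⊗_ : Code → Code → Code

El : Code → Set
El (fin m) = Fin m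
El (c ⊕ d) = El c ⊎ El d
El (c ⊗ d) = El c × El d

size : Code → ℕ
size (fin m) = m
size (c ⊕ d) = size c + size d
size (c ⊗ d) = size c * size d

enc : ∀ c → El c → Fin (size c)
enc (fin m) x = x
enc (c ⊕ d) (inj₁ x) = enc c x ↑ˡ size d
enc (c ⊕ d) (inj₂ y) = size c ↑ʳ enc d y
enc (c ⊗ d) (x , y) = combine (enc c x) (enc d y)

dec : ∀ c → Fin (size c) → El c
dec (fin m) i = i
dec (c ⊕ d) i = [ inj₁ ∘ dec c , inj₂ ∘ dec d ]′ (splitAt (size c) i)
dec (c ⊗ d) i = let (j , k) = remQuot (size d) i in dec c j , dec d k

dec-↑ˡ : ∀ c d i → dec (c ⊕ d) (i ↑ˡ size d) ≡ inj₁ (dec c i)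
dec-↑ˡ c d i = cong [ inj₁ ∘ dec c , inj₂ ∘ dec d ]′ (splitAt-↑ˡ (size c) i (size d))

dec-↑ʳ : ∀ c d j → dec (c ⊕ d) (size c ↑ʳ j) ≡ inj₂ (dec d j)
dec-↑ʳ c d j = cong [ inj₁ ∘ dec c , inj₂ ∘ dec d ]′ (splitAt-↑ʳ (size c) (size d) j)

dec-combine : ∀ c d i j → dec (c ⊗ d) (combine i j) ≡ (dec c i , dec d j)
dec-combine c d i j = cong (λ (k , l) → dec c k , dec d l) (remQuot-combine i j)

dec-enc : ∀ c x → dec c (enc c x) ≡ x
dec-enc (fin m) x = refl
dec-enc (c ⊕ d) (inj₁ x) = trans (dec-↑ˡ c d (enc c x)) (cong inj₁ (dec-enc c x))
dec-enc (c ⊕ d) (inj₂ y) = trans (dec-↑ʳ c d (enc d y)) (cong inj₂ (dec-enc d y))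
dec-enc (c ⊗ d) (x , y) = trans (dec-combine c d (enc c x) (enc d y)) (cong₂ _,_ (dec-enc c x) (dec-enc d y))

enc-dec : ∀ c i → enc c (dec c i) ≡ i
enc-dec (fin m) i = refl
enc-dec (c ⊕ d) i = trans (enc∘dec≗join (splitAt (size c) i)) (join-splitAt (size c) (size d) i)
  where
  enc∘dec≗join : ∀ s → enc (c ⊕ d) ([ inj₁ ∘ dec c , inj₂ ∘ dec d ]′ s) ≡ join (size c) (size d) s
  enc∘dec≗join (inj₁ j) = cong (_↑ˡ size d) (enc-dec c j)
  enc∘dec≗join (inj₂ j) = cong (size c ↑ʳ_) (enc-dec d j)
enc-dec (c ⊗ d) i = trans (cong₂ combine (enc-dec c _) (enc-dec d _)) (combine-remQuot {size c} (size d) i)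

enc-injective : ∀ c {x y} → enc c x ≡ enc c y → x ≡ y
enc-injective c {x} {y} h = trans (sym (dec-enc c x)) (trans (cong (dec c) h) (dec-enc c y))

ΣEl : ∀ c → (El c → ℕ) → ℕ
ΣEl (fin m) g = ∑[ i < m ] g i
ΣEl (c ⊕ d) g = ΣEl c (g ∘ inj₁) + ΣEl d (g ∘ inj₂)
ΣEl (c ⊗ d) g = ΣEl c (λ x → ΣEl d (λ y → g (x , y)))

∑-dec : ∀ c (g : El c → ℕ) → ∑[ i < size c ] g (dec c i) ≡ ΣEl c g
∑-dec (fin m) g = refl
∑-dec (c ⊕ d) g = begin
  ∑[ i < size c + size d ] g (dec (c ⊕ d) i)
    ≡⟨ ∑-↑ (size c) (g ∘ dec (c ⊕ d)) ⟩
  ∑[ i < size c ] g (dec (c ⊕ d) (i ↑ˡ size d)) + ∑[ j < size d ] g (dec (c ⊕ d) (size c ↑ʳ j))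
    ≡⟨ cong₂ _+_ (sum-cong-≗ (cong g ∘ dec-↑ˡ c d)) (sum-cong-≗ (cong g ∘ dec-↑ʳ c d)) ⟩
  ∑[ i < size c ] g (inj₁ (dec c i)) + ∑[ j < size d ] g (inj₂ (dec d j))
    ≡⟨ cong₂ _+_ (∑-dec c (g ∘ inj₁)) (∑-dec d (g ∘ inj₂)) ⟩
  ΣEl (c ⊕ d) g ∎
∑-dec (c ⊗ d) g = begin
  ∑[ k < size c * size d ] g (dec (c ⊗ d) k)
    ≡⟨ ∑-combine (size c) (size d) (g ∘ dec (c ⊗ d)) ⟩
  ∑[ i < size c ] ∑[ j < size d ] g (dec (c ⊗ d) (combine i j))
    ≡⟨ sum-cong-≗ (λ i → sum-cong-≗ (cong g ∘ dec-combine c d i)) ⟩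
  ∑[ i < size c ] ∑[ j < size d ] g (dec c i , dec d j)
    ≡⟨ sum-cong-≗ (λ i → ∑-dec d (λ y → g (dec c i , y))) ⟩
  ∑[ i < size c ] ΣEl d (λ y → g (dec c i , y))
    ≡⟨ ∑-dec c (λ x → ΣEl d (λ y → g (x , y))) ⟩
  ΣEl (c ⊗ d) g ∎

ΣEl-enc : ∀ c (f : Fin (size c) → ℕ) → ΣEl c (f ∘ enc c) ≡ ∑[ i < size c ] f i
ΣEl-enc c f = trans (sym (∑-dec c (f ∘ enc c))) (sum-cong-≗ (cong f ∘ enc-dec c))

ΣEl-zero : ∀ c → ΣEl c (λ _ → 0) ≡ 0
ΣEl-zero c = trans (sym (∑-dec c (λ _ → 0))) (sum-replicate-zero (size c))

ΣEl-∧ˡ : ∀ c β (w : El c → Bool) → ΣEl c (λ x → ⟦ β ∧ w x ⟧ᵇ) ≡ ⟦ β ⟧ᵇ * ΣEl c (λ x → ⟦ w x ⟧ᵇ)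
ΣEl-∧ˡ c true w = sym (+-identityʳ _)
ΣEl-∧ˡ c false w = ΣEl-zero c

-- Relational systems on coded finite types

Preserves : {A : Set} → (A → A) → (A → A → Bool) → Set
Preserves G r = ∀ x y → r x y ≡ true → r (G x) (G y) ≡ true

finRawMonoid : ∀ {n} → Op₂ (Fin n) → Fin n → RawMonoid 0ℓ 0ℓ
finRawMonoid {n} _·_ e = record { Carrier = Fin n ; _≈_ = _≡_ ; _∙_ = _·_ ; ε = e }

module RelationalSystemOn (V C : Code) (R : El C → El V → El V → Bool) where

  relSystem : RelSystem (size V) (size C)
  relSystem c u w = R (dec C c) (dec V u) (dec V w)

  localDegree : (El V → El V → Bool) → El V → ℕ
  localDegree r x = ΣEl V (λ u → ⟦ r x u ⟧ᵇ + ⟦ r u x ⟧ᵇ)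

  degree : El V → ℕ
  degree x = ΣEl C (λ c → localDegree (R c) x)

  totalDegree-relSystem : ∀ u → totalDegree relSystem u ≡ degree (dec V u)
  totalDegree-relSystem u = trans (ΣFin≡∑ (size C) _) (trans (sum-cong-≗ atColour) (∑-dec C _))
    where
    atColour : ∀ c → ΣFin (size V) (λ w → ⟦ relSystem c u w ⟧ᵇ + ⟦ relSystem c w u ⟧ᵇ)
                     ≡ localDegree (R (dec C c)) (dec V u)
    atColour c = trans (ΣFin≡∑ (size V) _) (∑-dec V _)

  IsEndomorphism : (El V → El V) → Set
  IsEndomorphism G = ∀ c → Preserves G (R c)

  toEndo : ∀ G → IsEndomorphism G → Endo relSystem
  toEndo G G-endo = endo (enc V ∘ G ∘ dec V) λ c u w h →
    trans (cong₂ (R (dec C c)) (dec-enc V _) (dec-enc V _)) (G-endo (dec C c) _ _ h)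

  fromEndo : Endo relSystem → El V → El V
  fromEndo f = dec V ∘ fun f ∘ enc V

  fromEndo-isEndomorphism : ∀ f → IsEndomorphism (fromEndo f)
  fromEndo-isEndomorphism f c x y h =
    subst (λ c′ → R c′ (fromEndo f x) (fromEndo f y) ≡ true) (dec-enc C c)
      (preserves f (enc C c) (enc V x) (enc V y) (trans relSystem-enc h))
    where
    relSystem-enc : relSystem (enc C c) (enc V x) (enc V y) ≡ R c x y
    relSystem-enc rewrite dec-enc C c | dec-enc V x | dec-enc V y = refl

  module Representation {n} {_·_ : Op₂ (Fin n)} {e : Fin n}
    (act : Fin n → El V → El V)
    (act-isEndomorphism : ∀ i → IsEndomorphism (act i))
    (act-∙ : ∀ i j x → act (i · j) x ≡ act i (act j x))
    (act-ε : ∀ x → act e x ≡ x)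
    (act-injective : ∀ {i j} → act i ≗ act j → i ≡ j)
    (act-exhaustive : ∀ G → IsEndomorphism G → ∃[ i ] G ≗ act i)
    where

    open MonoidMorphisms (finRawMonoid _·_ e) (Monoid.rawMonoid (EndMonoid relSystem))

    represent : Fin n → Endo relSystem
    represent i = toEndo (act i) (act-isEndomorphism i)

    represent-∙ : ∀ i j → represent (i · j) ≈ᴱ (represent i ∘ᴱ represent j)
    represent-∙ i j u = cong (enc V) (begin
      act (i · j) (dec V u)                    ≡⟨ act-∙ i j (dec V u) ⟩
      act i (act j (dec V u))                  ≡⟨ cong (act i) (dec-enc V (act j (dec V u))) ⟨
      act i (dec V (enc V (act j (dec V u))))  ∎)

    represent-ε : represent e ≈ᴱ idEndo relSystem
    represent-ε u = trans (cong (enc V) (act-ε (dec V u))) (enc-dec V u)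

    represent-injective : ∀ {i j} → represent i ≈ᴱ represent j → i ≡ j
    represent-injective {i} {j} h = act-injective λ x → begin
      act i x                  ≡⟨ cong (act i) (dec-enc V x) ⟨
      act i (dec V (enc V x))  ≡⟨ enc-injective V (h (enc V x)) ⟩
      act j (dec V (enc V x))  ≡⟨ cong (act j) (dec-enc V x) ⟩
      act j x                  ∎

    represent-surjective : ∀ f → ∃[ i ] represent i ≈ᴱ f
    represent-surjective f =
      let (i , f≗act) = act-exhaustive (fromEndo f) (fromEndo-isEndomorphism f) in
      i , λ u → begin
        enc V (act i (dec V u))       ≡⟨ cong (enc V) (f≗act (dec V u)) ⟨
        enc V (fromEndo f (dec V u))  ≡⟨ enc-dec V (fun f (enc V (dec V u))) ⟩
        fun f (enc V (dec V u))       ≡⟨ cong (fun f) (enc-dec V u) ⟩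
        fun f u                       ∎

    represent-isMonoidIsomorphism : IsMonoidIsomorphism represent
    represent-isMonoidIsomorphism = record
      { isMonoidMonomorphism = record
        { isMonoidHomomorphism = record
          { isMagmaHomomorphism = record
            { isRelHomomorphism = record { cong = λ { refl _ → refl } }
            ; homo = represent-∙
            }
          ; ε-homo = represent-ε
          }
        ; injective = represent-injective
        }
      ; surjective = λ f → let (i , i↦f) = represent-surjective f in i , λ { refl → i↦f }
      }

module FromBijection {c ℓ m} (M : Monoid c ℓ) (B : Bijection (setoid (Fin m)) (Monoid.setoid M)) where

  private module M = Monoid M
  open M using (_∙_; ε)
  open Inverse (Bijection⇒Inverse B) public using (from)
  open Inverse (Bijection⇒Inverse B) using (to; to-cong; from-cong; strictlyInverseˡ; strictlyInverseʳ)

  _·_ : Op₂ (Fin m)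
  i · j = from (to i ∙ to j)

  e : Fin m
  e = from ε

  to-isMonoidMonomorphism : MonoidMorphisms.IsMonoidMonomorphism (finRawMonoid _·_ e) M.rawMonoid to
  to-isMonoidMonomorphism = record
    { isMonoidHomomorphism = record
      { isMagmaHomomorphism = record
        { isRelHomomorphism = record { cong = to-cong }
        ; homo = λ i j → strictlyInverseˡ (to i ∙ to j)
        }
      ; ε-homo = strictlyInverseˡ ε
      }
    ; injective = Bijection.injective B
    }

  ·-isMonoid : IsMonoid _≡_ _·_ e
  ·-isMonoid = MonoidMonomorphism.isMonoid to-isMonoidMonomorphism M.isMonoid

  from-isMonoidIsomorphism : MonoidMorphisms.IsMonoidIsomorphism M.rawMonoid (finRawMonoid _·_ e) from
  from-isMonoidIsomorphism = record
    { isMonoidMonomorphism = record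
      { isMonoidHomomorphism = record
        { isMagmaHomomorphism = record
          { isRelHomomorphism = record { cong = from-cong }
          ; homo = λ x y → from-cong (M.∙-cong (M.sym (strictlyInverseˡ x)) (M.sym (strictlyInverseˡ y)))
          }
        ; ε-homo = refl
        }
      ; injective = λ {x} {y} h →
          M.trans (M.sym (strictlyInverseˡ x)) (M.trans (M.reflexive (cong to h)) (strictlyInverseˡ y))
      }
    ; surjective = λ i → to i , λ z≈to-i → trans (from-cong z≈to-i) (strictlyInverseʳ i)
    }

-- The regular relational system of a monoid on Fin n

data Axis : Set where
  X Y Z : Axis

pick : {A : Set} → Axis → A → A → A → A
pick X x y z = x
pick Y x y z = y
pick Z x y z = z

pick-map : {A B : Set} (f : A → B) → ∀ k x y z → f (pick k x y z) ≡ pick k (f x) (f y) (f z)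
pick-map f X x y z = refl
pick-map f Y x y z = refl
pick-map f Z x y z = refl

module Construction {n′ : ℕ} {_·_ : Op₂ (Fin (suc n′))} {e : Fin (suc n′)}
                    (isMonoid : IsMonoid _≡_ _·_ e) where

  open IsMonoid isMonoid using (assoc; identityˡ; identityʳ)

  n : ℕ
  n = suc n′

  -- In the gadget over a, inj₁ (x , y) is the triple (x, y, y) and inj₂ (x , j) is (x, y, x · a)
  -- with y the j-th element other than x · a, so that every admissible triple occurs once.
  Triple : Code
  Triple = (fin n ⊗ fin n) ⊕ (fin n ⊗ fin n′)

  coordinate : Axis → Fin n → El Triple → Fin n
  coordinate k a (inj₁ (x , y)) = pick k x y y
  coordinate k a (inj₂ (x , j)) = pick k x (punchIn (x · a) j) (x · a)

  triple : Fin n → Fin n → Fin n → El Triple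
  triple a x y with x · a ≟ y
  ... | yes _ = inj₁ (x , y)
  ... | no xa≢y = inj₂ (x , punchOut xa≢y)

  coordinate-triple : ∀ k a x y → coordinate k a (triple a x y) ≡ pick k x y (x · a)
  coordinate-triple k a x y with x · a ≟ y
  ... | yes xa≡y = cong (pick k x y) (sym xa≡y)
  ... | no xa≢y = cong (λ y′ → pick k x y′ (x · a)) (punchIn-punchOut xa≢y)

  coordinates-injective : ∀ a q q′ → (∀ k → coordinate k a q ≡ coordinate k a q′) → q ≡ q′
  coordinates-injective a (inj₁ (x , y)) (inj₁ (x′ , y′)) h = cong inj₁ (cong₂ _,_ (h X) (h Y))
  coordinates-injective a (inj₁ (x , y)) (inj₂ (x′ , j′)) h =
    ⊥-elim (punchInᵢ≢i (x′ · a) j′ (trans (sym (h Y)) (h Z)))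
  coordinates-injective a (inj₂ (x , j)) (inj₁ (x′ , y′)) h =
    ⊥-elim (punchInᵢ≢i (x · a) j (trans (h Y) (sym (h Z))))
  coordinates-injective a (inj₂ (x , j)) (inj₂ (x′ , j′)) h with refl ← h X =
    cong (λ j″ → inj₂ (x , j″)) (punchIn-injective (x · a) j j′ (h Y))

  actTriple : Fin n → Fin n → El Triple → El Triple
  actTriple a i (inj₁ (x , y)) = inj₁ (i · x , i · y)
  actTriple a i (inj₂ (x , j)) = triple a (i · x) (i · punchIn (x · a) j)

  coordinate-act : ∀ k a i q → coordinate k a (actTriple a i q) ≡ i · coordinate k a q
  coordinate-act k a i (inj₁ (x , y)) = sym (pick-map (i ·_) k x y y)
  coordinate-act k a i (inj₂ (x , j)) = begin
    coordinate k a (triple a (i · x) (i · y))  ≡⟨ coordinate-triple k a (i · x) (i · y) ⟩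
    pick k (i · x) (i · y) ((i · x) · a)       ≡⟨ cong (pick k (i · x) (i · y)) (assoc i x a) ⟩
    pick k (i · x) (i · y) (i · (x · a))       ≡⟨ pick-map (i ·_) k x y (x · a) ⟨
    i · pick k x y (x · a)                     ∎
    where
    y : Fin n
    y = punchIn (x · a) j

  actTriple-∙ : ∀ a i j q → actTriple a (i · j) q ≡ actTriple a i (actTriple a j q)
  actTriple-∙ a i j q = coordinates-injective a _ _ λ k → begin
    coordinate k a (actTriple a (i · j) q)           ≡⟨ coordinate-act k a (i · j) q ⟩
    (i · j) · coordinate k a q                       ≡⟨ assoc i j _ ⟩
    i · (j · coordinate k a q)                       ≡⟨ cong (i ·_) (coordinate-act k a j q) ⟨
    i · coordinate k a (actTriple a j q)             ≡⟨ coordinate-act k a i (actTriple a j q) ⟨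
    coordinate k a (actTriple a i (actTriple a j q)) ∎

  actTriple-ε : ∀ a q → actTriple a e q ≡ q
  actTriple-ε a q = coordinates-injective a _ _ λ k → trans (coordinate-act k a e q) (identityˡ _)

  Gadget : Code
  Gadget = fin n ⊗ Triple

  Vertex : Code
  Vertex = fin n ⊕ Gadget

  act : Fin n → El Vertex → El Vertex
  act i (inj₁ x) = inj₁ (i · x)
  act i (inj₂ (a , q)) = inj₂ (a , actTriple a i q)

  act-∙ : ∀ i j x → act (i · j) x ≡ act i (act j x)
  act-∙ i j (inj₁ x) = cong inj₁ (assoc i j x)
  act-∙ i j (inj₂ (a , q)) = cong (λ r → inj₂ (a , r)) (actTriple-∙ a i j q)

  act-ε : ∀ x → act e x ≡ x
  act-ε (inj₁ x) = cong inj₁ (identityˡ x)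
  act-ε (inj₂ (a , q)) = cong (λ r → inj₂ (a , r)) (actTriple-ε a q)

  act-injective : ∀ {i j} → act i ≗ act j → i ≡ j
  act-injective {i} {j} h = begin
    i      ≡⟨ identityʳ i ⟨
    i · e  ≡⟨ inj₁-injective (h (inj₁ e)) ⟩
    j · e  ≡⟨ identityʳ j ⟩
    j      ∎

  cayley : Fin n → El Vertex → El Vertex → Bool
  cayley a (inj₁ x) (inj₁ y) = x · a == y
  cayley a _ _ = false

  projection : Axis → Fin n → El Vertex → El Vertex → Bool
  projection k a (inj₂ (b , q)) (inj₁ w) = (a == b) ∧ (coordinate k b q == w)
  projection k a _ _ = false

  loop : El Vertex → El Vertex → Bool
  loop (inj₂ s) (inj₂ t) = enc Gadget s == enc Gadget t
  loop _ _ = false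

  Kind : Code
  Kind = fin 3 ⊕ fin n

  relationOfKind : Fin n → El Kind → El Vertex → El Vertex → Bool
  relationOfKind a (inj₁ zero) = cayley a
  relationOfKind a (inj₁ (suc zero)) = projection X a
  relationOfKind a (inj₁ (suc (suc zero))) = projection Z a
  relationOfKind a (inj₂ _) = projection Y a

  K : ℕ
  K = n * (3 + 2 * n)

  padding : ℕ
  padding = n * K ∸ (2 + n)

  -- Every non-loop relation is taken twice to make the degrees even: a loop adds 2 to the
  -- degree of a gadget vertex.
  Colour : Code
  Colour = (fin 2 ⊗ (fin n ⊗ Kind)) ⊕ fin padding

  relation : El Colour → El Vertex → El Vertex → Bool
  relation (inj₁ (_ , a , k)) = relationOfKind a k
  relation (inj₂ _) = loop

  open RelationalSystemOn Vertex Colour relation public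

  cayley-preserved : ∀ a i → Preserves (act i) (cayley a)
  cayley-preserved a i (inj₁ x) (inj₁ y) h = ≡⇒== (trans (assoc i x a) (cong (i ·_) (==⇒≡ h)))
  cayley-preserved a i (inj₁ x) (inj₂ _) ()
  cayley-preserved a i (inj₂ _) _ ()

  projection-preserved : ∀ k a i → Preserves (act i) (projection k a)
  projection-preserved k a i (inj₂ (b , q)) (inj₁ w) h =
    let (a≡b , qₖ≡w) = ∧-true h in
    ∧-intro a≡b (≡⇒== (trans (coordinate-act k b i q) (cong (i ·_) (==⇒≡ qₖ≡w))))
  projection-preserved k a i (inj₁ _) _ ()
  projection-preserved k a i (inj₂ _) (inj₂ _) ()

  loop-preserved : ∀ i → Preserves (act i) loop
  loop-preserved i (inj₂ (b , q)) (inj₂ t) h with refl ← enc-injective Gadget {b , q} {t} (==⇒≡ h) =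
    ==-refl (enc Gadget (b , actTriple b i q))
  loop-preserved i (inj₁ _) _ ()
  loop-preserved i (inj₂ _) (inj₁ _) ()

  act-isEndomorphism : ∀ i → IsEndomorphism (act i)
  act-isEndomorphism i (inj₁ (_ , a , inj₁ zero)) = cayley-preserved a i
  act-isEndomorphism i (inj₁ (_ , a , inj₁ (suc zero))) = projection-preserved X a i
  act-isEndomorphism i (inj₁ (_ , a , inj₁ (suc (suc zero)))) = projection-preserved Z a i
  act-isEndomorphism i (inj₁ (_ , a , inj₂ _)) = projection-preserved Y a i
  act-isEndomorphism i (inj₂ _) = loop-preserved i

  monoidPart : El Vertex → Fin n
  monoidPart (inj₁ x) = x
  monoidPart (inj₂ _) = e

  cayley-target : ∀ a s t → cayley a s t ≡ true → t ≡ inj₁ (monoidPart s · a)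
  cayley-target a (inj₁ x) (inj₁ y) h = cong inj₁ (sym (==⇒≡ h))
  cayley-target a (inj₁ x) (inj₂ _) ()
  cayley-target a (inj₂ _) t ()

  projection-source : ∀ k a s w → projection k a s (inj₁ w) ≡ true → ∃[ q ] s ≡ inj₂ (a , q)
  projection-source k a (inj₂ (b , q)) w h with refl ← ==⇒≡ {x = a} {b} (proj₁ (∧-true h)) = q , refl
  projection-source k a (inj₁ _) w ()

  projection-coordinate : ∀ k a b q w → projection k a (inj₂ (b , q)) (inj₁ w) ≡ true → coordinate k b q ≡ w
  projection-coordinate k a b q w h = ==⇒≡ (proj₂ (∧-true h))

  act-exhaustive : ∀ G → IsEndomorphism G → ∃[ i ] G ≗ act i
  act-exhaustive G G-endo = i₀ , λ { (inj₁ x) → on-monoid x ; (inj₂ (b , q)) → on-gadget b q }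
    where
    i₀ : Fin n
    i₀ = monoidPart (G (inj₁ e))

    cayley-arc : ∀ x → cayley x (G (inj₁ e)) (G (inj₁ (e · x))) ≡ true
    cayley-arc x = G-endo (inj₁ (zero , x , inj₁ zero)) (inj₁ e) (inj₁ (e · x)) (==-refl (e · x))

    on-monoid : ∀ x → G (inj₁ x) ≡ inj₁ (i₀ · x)
    on-monoid x = begin
      G (inj₁ x)        ≡⟨ cong (G ∘ inj₁) (identityˡ x) ⟨
      G (inj₁ (e · x))  ≡⟨ cayley-target x (G (inj₁ e)) (G (inj₁ (e · x))) (cayley-arc x) ⟩
      inj₁ (i₀ · x)     ∎

    preserves-projection : ∀ k b → Preserves G (projection k b)
    preserves-projection X b = G-endo (inj₁ (zero , b , inj₁ (suc zero)))
    preserves-projection Y b = G-endo (inj₁ (zero , b , inj₂ zero))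
    preserves-projection Z b = G-endo (inj₁ (zero , b , inj₁ (suc (suc zero))))

    projection-arc : ∀ k b q → projection k b (G (inj₂ (b , q))) (inj₁ (i₀ · coordinate k b q)) ≡ true
    projection-arc k b q =
      subst (λ t → projection k b (G (inj₂ (b , q))) t ≡ true) (on-monoid (coordinate k b q))
        (preserves-projection k b (inj₂ (b , q)) (inj₁ (coordinate k b q))
          (∧-intro (==-refl b) (==-refl (coordinate k b q))))

    on-gadget : ∀ b q → G (inj₂ (b , q)) ≡ inj₂ (b , actTriple b i₀ q)
    on-gadget b q with projection-source X b (G (inj₂ (b , q))) _ (projection-arc X b q)
    ... | q′ , G≡ = trans G≡ (cong (λ r → inj₂ (b , r)) (coordinates-injective b q′ (actTriple b i₀ q) agree))
      where
      agree : ∀ k → coordinate k b q′ ≡ coordinate k b (actTriple b i₀ q)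
      agree k = begin
        coordinate k b q′                  ≡⟨ projection-coordinate k b b q′ _ arc ⟩
        i₀ · coordinate k b q              ≡⟨ coordinate-act k b i₀ q ⟨
        coordinate k b (actTriple b i₀ q)  ∎
        where
        arc : projection k b (inj₂ (b , q′)) (inj₁ (i₀ · coordinate k b q)) ≡ true
        arc = subst (λ s → projection k b s (inj₁ (i₀ · coordinate k b q)) ≡ true) G≡ (projection-arc k b q)

  cayleyFibre : Fin n → Fin n → ℕ
  cayleyFibre a v = ∑[ x < n ] ⟦ x · a == v ⟧ᵇ

  cayleyCofibre : Fin n → Fin n → ℕ
  cayleyCofibre a v = ∑[ x < n ] ∑[ j < n′ ] ⟦ punchIn (x · a) j == v ⟧ᵇ

  coordinateFibre : Axis → Fin n → Fin n → ℕ
  coordinateFibre k a v = ΣEl Triple (λ q → ⟦ coordinate k a q == v ⟧ᵇ)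

  ∑∑-δ-inner : ∀ m (v : Fin n) → ∑[ x < m ] ∑[ y < n ] ⟦ y == v ⟧ᵇ ≡ m
  ∑∑-δ-inner m v = begin
    ∑[ x < m ] ∑[ y < n ] ⟦ y == v ⟧ᵇ  ≡⟨ sum-cong-≗ {m} (λ _ → ∑-δ′ v) ⟩
    ∑[ x < m ] 1                      ≡⟨ ∑-1 m ⟩
    m                                 ∎

  ∑∑-δ-outer : ∀ m (v : Fin n) → ∑[ x < n ] ∑[ j < m ] ⟦ x == v ⟧ᵇ ≡ m
  ∑∑-δ-outer m v = begin
    ∑[ x < n ] ∑[ j < m ] ⟦ x == v ⟧ᵇ  ≡⟨ ∑-comm {n} {m} (λ x _ → ⟦ x == v ⟧ᵇ) ⟩
    ∑[ j < m ] ∑[ x < n ] ⟦ x == v ⟧ᵇ  ≡⟨ ∑∑-δ-inner m v ⟩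
    m                                 ∎

  cayleyFibre+cayleyCofibre : ∀ a v → cayleyFibre a v + cayleyCofibre a v ≡ n
  cayleyFibre+cayleyCofibre a v = begin
    cayleyFibre a v + cayleyCofibre a v
      ≡⟨ ∑-distrib-+ (λ x → ⟦ x · a == v ⟧ᵇ) (λ x → ∑[ j < n′ ] ⟦ punchIn (x · a) j == v ⟧ᵇ) ⟨
    ∑[ x < n ] (⟦ x · a == v ⟧ᵇ + ∑[ j < n′ ] ⟦ punchIn (x · a) j == v ⟧ᵇ)
      ≡⟨ sum-cong-≗ (λ x → sum-remove {i = x · a} (λ y → ⟦ y == v ⟧ᵇ)) ⟨
    ∑[ x < n ] ∑[ y < n ] ⟦ y == v ⟧ᵇ
      ≡⟨ ∑∑-δ-inner n v ⟩
    n ∎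

  coordinateFibre-X : ∀ a v → coordinateFibre X a v ≡ n + n′
  coordinateFibre-X a v = cong₂ _+_ (∑∑-δ-outer n v) (∑∑-δ-outer n′ v)

  coordinateFibre-Y : ∀ a v → coordinateFibre Y a v ≡ n + cayleyCofibre a v
  coordinateFibre-Y a v = cong (_+ cayleyCofibre a v) (∑∑-δ-inner n v)

  coordinateFibre-Z : ∀ a v → coordinateFibre Z a v ≡ n + n′ * cayleyFibre a v
  coordinateFibre-Z a v = cong₂ _+_ (∑∑-δ-inner n v)
    (trans (∑-comm {n} {n′} (λ x _ → ⟦ x · a == v ⟧ᵇ)) (∑-const n′ (cayleyFibre a v)))

  localDegree-cayley-monoid : ∀ a v → localDegree (cayley a) (inj₁ v) ≡ 1 + cayleyFibre a v
  localDegree-cayley-monoid a v = begin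
    ∑[ y < n ] (⟦ v · a == y ⟧ᵇ + ⟦ y · a == v ⟧ᵇ) + ΣEl Gadget (λ _ → 0)
      ≡⟨ cong₂ _+_ (∑-distrib-+ (λ y → ⟦ v · a == y ⟧ᵇ) (λ y → ⟦ y · a == v ⟧ᵇ)) (ΣEl-zero Gadget) ⟩
    (∑[ y < n ] ⟦ v · a == y ⟧ᵇ + cayleyFibre a v) + 0
      ≡⟨ +-identityʳ _ ⟩
    ∑[ y < n ] ⟦ v · a == y ⟧ᵇ + cayleyFibre a v
      ≡⟨ cong (_+ cayleyFibre a v) (∑-δ (v · a)) ⟩
    1 + cayleyFibre a v ∎

  localDegree-cayley-gadget : ∀ a s → localDegree (cayley a) (inj₂ s) ≡ 0
  localDegree-cayley-gadget a s = ΣEl-zero Vertex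

  localDegree-projection-monoid : ∀ k a v → localDegree (projection k a) (inj₁ v) ≡ coordinateFibre k a v
  localDegree-projection-monoid k a v = begin
    ∑[ w < n ] 0 + ∑[ b < n ] ΣEl Triple (λ q → ⟦ (a == b) ∧ (coordinate k b q == v) ⟧ᵇ)
      ≡⟨ cong₂ _+_ (sum-replicate-zero n) (sum-cong-≗ (λ b → ΣEl-∧ˡ Triple (a == b) (λ q → coordinate k b q == v))) ⟩
    ∑[ b < n ] (⟦ a == b ⟧ᵇ * coordinateFibre k b v)
      ≡⟨ ∑-select a (λ b → coordinateFibre k b v) ⟩
    coordinateFibre k a v ∎

  localDegree-projection-gadget : ∀ k a b q → localDegree (projection k a) (inj₂ (b , q)) ≡ ⟦ a == b ⟧ᵇ
  localDegree-projection-gadget k a b q = begin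
    ∑[ w < n ] (⟦ (a == b) ∧ (coordinate k b q == w) ⟧ᵇ + 0) + ΣEl Gadget (λ _ → 0)
      ≡⟨ cong₂ _+_ (sum-cong-≗ (λ w → +-identityʳ ⟦ (a == b) ∧ (coordinate k b q == w) ⟧ᵇ)) (ΣEl-zero Gadget) ⟩
    ∑[ w < n ] ⟦ (a == b) ∧ (coordinate k b q == w) ⟧ᵇ + 0
      ≡⟨ +-identityʳ _ ⟩
    ∑[ w < n ] ⟦ (a == b) ∧ (coordinate k b q == w) ⟧ᵇ
      ≡⟨ ΣEl-∧ˡ (fin n) (a == b) (λ w → coordinate k b q == w) ⟩
    ⟦ a == b ⟧ᵇ * ∑[ w < n ] ⟦ coordinate k b q == w ⟧ᵇ
      ≡⟨ cong (⟦ a == b ⟧ᵇ *_) (∑-δ (coordinate k b q)) ⟩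
    ⟦ a == b ⟧ᵇ * 1
      ≡⟨ *-identityʳ _ ⟩
    ⟦ a == b ⟧ᵇ ∎

  localDegree-loop-monoid : ∀ v → localDegree loop (inj₁ v) ≡ 0
  localDegree-loop-monoid v = ΣEl-zero Vertex

  localDegree-loop-gadget : ∀ s → localDegree loop (inj₂ s) ≡ 2
  localDegree-loop-gadget s = begin
    ∑[ w < n ] 0 + ΣEl Gadget (λ t → ⟦ ŝ == enc Gadget t ⟧ᵇ + ⟦ enc Gadget t == ŝ ⟧ᵇ)
      ≡⟨ cong₂ _+_ (sum-replicate-zero n) (ΣEl-enc Gadget (λ i → ⟦ ŝ == i ⟧ᵇ + ⟦ i == ŝ ⟧ᵇ)) ⟩
    ∑[ i < size Gadget ] (⟦ ŝ == i ⟧ᵇ + ⟦ i == ŝ ⟧ᵇ)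
      ≡⟨ ∑-distrib-+ (λ i → ⟦ ŝ == i ⟧ᵇ) (λ i → ⟦ i == ŝ ⟧ᵇ) ⟩
    ∑[ i < size Gadget ] ⟦ ŝ == i ⟧ᵇ + ∑[ i < size Gadget ] ⟦ i == ŝ ⟧ᵇ
      ≡⟨ cong₂ _+_ (∑-δ ŝ) (∑-δ′ ŝ) ⟩
    2 ∎
    where
    ŝ : Fin (size Gadget)
    ŝ = enc Gadget s

  kindDegree : Fin n → El Vertex → ℕ
  kindDegree a x = ΣEl Kind (λ k → localDegree (relationOfKind a k) x)

  kindDegree-monoid : ∀ a v → kindDegree a (inj₁ v) ≡ K
  kindDegree-monoid a v = begin
    kindDegree a (inj₁ v)
      ≡⟨ cong₂ _+_ (cong₂ _+_ (localDegree-cayley-monoid a v)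
                     (cong₂ _+_ (projection-monoid X (coordinateFibre-X a v))
                                (cong (_+ 0) (projection-monoid Z (coordinateFibre-Z a v)))))
                   (trans (∑-const n _) (cong (n *_) (projection-monoid Y (coordinateFibre-Y a v)))) ⟩
    (1 + A) + ((n + n′) + ((n + n′ * A) + 0)) + n * (n + B)
      ≡⟨ arithmetic n′ A B ⟩
    n * (3 + n) + n * (A + B)
      ≡⟨ cong (λ m → n * (3 + n) + n * m) (cayleyFibre+cayleyCofibre a v) ⟩
    n * (3 + n) + n * n
      ≡⟨ arithmetic′ n ⟩
    K ∎
    where
    A B : ℕ
    A = cayleyFibre a v
    B = cayleyCofibre a v
    projection-monoid : ∀ k {m} → coordinateFibre k a v ≡ m → localDegree (projection k a) (inj₁ v) ≡ m
    projection-monoid k = trans (localDegree-projection-monoid k a v)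
    arithmetic : ∀ n′ A B → (1 + A) + ((suc n′ + n′) + ((suc n′ + n′ * A) + 0)) + suc n′ * (suc n′ + B)
                            ≡ suc n′ * (3 + suc n′) + suc n′ * (A + B)
    arithmetic = solve-∀
    arithmetic′ : ∀ n → n * (3 + n) + n * n ≡ n * (3 + 2 * n)
    arithmetic′ = solve-∀

  kindDegree-gadget : ∀ a b q → kindDegree a (inj₂ (b , q)) ≡ ⟦ a == b ⟧ᵇ * (2 + n)
  kindDegree-gadget a b q = begin
    kindDegree a (inj₂ (b , q))
      ≡⟨ cong₂ _+_ (cong₂ _+_ (localDegree-cayley-gadget a (b , q))
                     (cong₂ _+_ (projection-gadget X) (cong (_+ 0) (projection-gadget Z))))
                   (trans (∑-const n _) (cong (n *_) (projection-gadget Y))) ⟩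
    (0 + (δ + (δ + 0))) + n * δ
      ≡⟨ arithmetic n δ ⟩
    δ * (2 + n) ∎
    where
    δ : ℕ
    δ = ⟦ a == b ⟧ᵇ
    projection-gadget : ∀ k → localDegree (projection k a) (inj₂ (b , q)) ≡ δ
    projection-gadget k = localDegree-projection-gadget k a b q
    arithmetic : ∀ n δ → (0 + (δ + (δ + 0))) + n * δ ≡ δ * (2 + n)
    arithmetic = solve-∀

  degree-by-kind : ∀ x → degree x ≡ 2 * ∑[ a < n ] kindDegree a x + padding * localDegree loop x
  degree-by-kind x = cong₂ _+_ (∑-const 2 (∑[ a < n ] kindDegree a x)) (∑-const padding (localDegree loop x))

  2+n≤n*K : 2 + n ≤ n * K
  2+n≤n*K = ≤-trans (+-mono-≤ (n≤1+n 2) (m≤n*m n 2)) (≤-trans (m≤n*m (3 + 2 * n) n) (m≤n*m K n))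

  degree-constant : ∀ x → degree x ≡ 2 * (n * K)
  degree-constant (inj₁ v) = begin
    degree (inj₁ v)
      ≡⟨ degree-by-kind (inj₁ v) ⟩
    2 * ∑[ a < n ] kindDegree a (inj₁ v) + padding * localDegree loop (inj₁ v)
      ≡⟨ cong₂ (λ s l → 2 * s + padding * l)
           (trans (sum-cong-≗ (λ a → kindDegree-monoid a v)) (∑-const n K)) (localDegree-loop-monoid v) ⟩
    2 * (n * K) + padding * 0
      ≡⟨ cong (2 * (n * K) +_) (*-zeroʳ padding) ⟩
    2 * (n * K) + 0
      ≡⟨ +-identityʳ _ ⟩
    2 * (n * K) ∎
  degree-constant (inj₂ (b , q)) = begin
    degree (inj₂ (b , q))
      ≡⟨ degree-by-kind (inj₂ (b , q)) ⟩
    2 * ∑[ a < n ] kindDegree a (inj₂ (b , q)) + padding * localDegree loop (inj₂ (b , q))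
      ≡⟨ cong₂ (λ s l → 2 * s + padding * l)
           (trans (sum-cong-≗ (λ a → kindDegree-gadget a b q)) (∑-select′ b (λ _ → 2 + n)))
           (localDegree-loop-gadget (b , q)) ⟩
    2 * (2 + n) + padding * 2
      ≡⟨ cong (2 * (2 + n) +_) (*-comm padding 2) ⟩
    2 * (2 + n) + 2 * padding
      ≡⟨ *-distribˡ-+ 2 (2 + n) padding ⟨
    2 * ((2 + n) + padding)
      ≡⟨ cong (2 *_) (trans (+-comm (2 + n) padding) (m∸n+n≡m 2+n≤n*K)) ⟩
    2 * (n * K) ∎

  open Representation act act-isEndomorphism act-∙ act-ε act-injective act-exhaustive public

  relSystem-regular : ∀ u w → totalDegree relSystem u ≡ totalDegree relSystem w
  relSystem-regular u w = begin
    totalDegree relSystem u   ≡⟨ totalDegree-relSystem u ⟩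
    degree (dec Vertex u)     ≡⟨ degree-constant (dec Vertex u) ⟩
    2 * (n * K)               ≡⟨ degree-constant (dec Vertex w) ⟨
    degree (dec Vertex w)     ≡⟨ totalDegree-relSystem w ⟨
    totalDegree relSystem w   ∎

lemma5p5 : ∀ {c ℓ} (M : Monoid c ℓ) → IsFiniteMonoid M →
    ∃[ n ] ∃[ k ] Σ (RelSystem n k) (λ A →
      (∀ v w → totalDegree A v ≡ totalDegree A w) × (M ≅ᴹ EndMonoid A))
lemma5p5 M (zero , B) with () ← Bijection.to⁻ B (Monoid.ε M)
lemma5p5 M (suc n′ , B) = _ , _ , relSystem , relSystem-regular , M≅End
  where
  open FromBijection M B
  open Construction ·-isMonoid

  M≅End : M ≅ᴹ EndMonoid relSystem
  M≅End = represent ∘ from ,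
    -- transitivity of _≈ᴱ_ written out: Monoid.trans would need implicit arguments that
    -- _≈ᴱ_ does not determine
    isMonoidIsomorphism (λ p q x → trans (p x) (q x)) from-isMonoidIsomorphism represent-isMonoidIsomorphism
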